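{- Let $M$ be a matrix from the with-replacement model $\underline{M}(3,1,n)$ and let $B_1,\dots,B_k\subseteq[n]$. Then $B_1,\dots,B_k$ are all dependencies of $M$ if and only if the following holds for every $i\in[n]$: if $i\in I_{\underline{x}}$ and the two random unit entries $e_1(i),e_2(i)$ of column $i$ lie in rows belonging to $I_{\underline{u}}$ and $I_{\underline{v}}$ respectively, then $\underline{x}=\underline{u}+\underline{v}\pmod 2$.
   Context: With-replacement model $\underline{M}(3,1,n)$: random $n\times n$ matrix over $GF(2)$ with independent columns; column $i$ has a unit entry in row $i$ plus two unit entries in rows $e_1(i),e_2(i)$ chosen independently and uniformly from $[n]$, entries added mod 2; all other entries zero. A set $B\subseteq[n]$ is a dependency if the rows of $M$ indexed by $B$ sum to zero over $GF(2)$. For $\underline{x}\in\{0,1\}^k$, $I_{\underline{x}}=\bigcap_{i=1}^kB_i^{(x_i)}$, where $B_i^{(1)}=B_i$ and $B_i^{(0)}=[n]\setminus B_i$. -}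

module Defs where

open import Data.Bool using (Bool; true; false; _xor_; _∧_)
open import Data.Nat using (ℕ)
open import Data.Fin using (Fin)
open import Data.Fin.Properties using (_≟_)
open import Data.Fin.Subset using (Subset)
open import Data.Vec using (Vec; lookup; tabulate; foldr; zipWith)
open import Relation.Nullary.Decidable using (⌊_⌋)
open import Relation.Binary.PropositionalEquality using (_≡_)

-- A matrix over GF(2) (Bool with xor as addition); entry  M row col.
Matrix : ℕ → Set
Matrix n = Fin n → Fin n → Bool

-- Realisation of the with-replacement model M(3,1,n): given the random
-- choices e₁ e₂ : [n] → [n], column i has unit entries in rows i, e₁ i, e₂ i,
-- added mod 2.
modelMatrix : {n : ℕ} → (e₁ e₂ : Fin n → Fin n) → Matrix n
modelMatrix e₁ e₂ row col =
  (⌊ row ≟ col ⌋ xor ⌊ row ≟ e₁ col ⌋) xor ⌊ row ≟ e₂ col ⌋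

rowSumAt : {n : ℕ} → Matrix n → Subset n → Fin n → Bool
rowSumAt {n} M B col = foldr (λ _ → Bool) _xor_ false
  (tabulate (λ row → lookup B row ∧ M row col))

IsDependency : {n : ℕ} → Matrix n → Subset n → Set
IsDependency M B = ∀ col → rowSumAt M B col ≡ false

-- j ∈ I_x  where  I_x = ⋂_t B_t^(x_t).
InI : {n k : ℕ} → (Fin k → Subset n) → Vec Bool k → Fin n → Set
InI Bs x j = ∀ t → lookup (Bs t) j ≡ lookup x t

_⊕_ : {k : ℕ} → Vec Bool k → Vec Bool k → Vec Bool k
_⊕_ = zipWith _xor_

-- Column i of the matrix has ones exactly in rows i, e₁ i, e₂ i (counted mod 2), so the
-- rows indexed by B sum to zero in column i iff [i ∈ B] = [e₁ i ∈ B] + [e₂ i ∈ B] in GF(2).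
-- The vector x with i ∈ I_x is the membership pattern (i ∈ B_1, …, i ∈ B_k) of i, so
-- imposing this for every B_t at once is exactly the condition x = u + v.
module Submission where

open import Defs
open import Algebra.Bundles using (CommutativeMonoid; CommutativeRing)
open import Data.Nat using (ℕ; zero; suc)
open import Data.Bool using (Bool; true; false; _xor_; _∧_)
open import Data.Bool.Properties
  using (xor-assoc; ∧-distribˡ-xor; ∧-zeroʳ; ∧-identityʳ; xor-∧-commutativeRing)
open import Data.Fin using (Fin; zero; suc)
open import Data.Fin.Subset using (Subset)
open import Data.Fin.Properties using (_≟_; punchInᵢ≢i)
open import Data.Vec using (Vec; lookup; tabulate; foldr)
open import Data.Vec.Functional using (Vector; removeAt; replicate)
open import Data.Vec.Properties using (lookup-zipWith; lookup∘tabulate)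
open import Data.Vec.Relation.Binary.Pointwise.Extensional using (ext; Pointwise-≡⇒≡)
open import Data.Product using (_×_; _,_)
open import Function.Bundles using (_⇔_; mk⇔; Equivalence)
open import Relation.Nullary.Decidable using (⌊_⌋; isYes≗does; dec-true; dec-false)
open import Relation.Binary.PropositionalEquality
  using (_≡_; _≢_; refl; sym; trans; cong; cong₂; module ≡-Reasoning)

module _ {c ℓ} (M : CommutativeMonoid c ℓ) where
  open CommutativeMonoid M
  open import Algebra.Properties.CommutativeMonoid.Sum M
  open import Relation.Binary.Reasoning.Setoid setoid

  sum-supported : ∀ {n} (f : Vector Carrier (suc n)) (i : Fin (suc n)) →
                  (∀ j → j ≢ i → f j ≈ ε) → sum f ≈ f i
  sum-supported {n} f i vanishes = begin
    sum f                      ≈⟨ sum-remove f ⟩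
    f i ∙ sum (removeAt f i)   ≈⟨ ∙-congˡ (sum-cong-≋ (λ j → vanishes _ (punchInᵢ≢i i j))) ⟩
    f i ∙ sum (replicate n ε)  ≈⟨ ∙-congˡ (sum-replicate-zero n) ⟩
    f i ∙ ε                    ≈⟨ identityʳ (f i) ⟩
    f i                        ∎

open CommutativeRing xor-∧-commutativeRing using (+-commutativeMonoid)
open import Algebra.Properties.CommutativeMonoid.Sum +-commutativeMonoid
  using (sum; sum-cong-≗; ∑-distrib-+)

foldr-xor-tabulate : ∀ {n} (f : Fin n → Bool) →
                     foldr (λ _ → Bool) _xor_ false (tabulate f) ≡ sum f
foldr-xor-tabulate {zero} f = refl
foldr-xor-tabulate {suc n} f = cong (f zero xor_) (foldr-xor-tabulate (λ j → f (suc j)))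

sum-∧-δ : ∀ {n} (f : Fin n → Bool) (i : Fin n) → sum (λ j → f j ∧ ⌊ j ≟ i ⌋) ≡ f i
sum-∧-δ {suc n} f i = begin
  sum (λ j → f j ∧ ⌊ j ≟ i ⌋) ≡⟨ sum-supported +-commutativeMonoid _ i off-diagonal ⟩
  f i ∧ ⌊ i ≟ i ⌋             ≡⟨ cong (f i ∧_) (trans (isYes≗does (i ≟ i)) (dec-true (i ≟ i) refl)) ⟩
  f i ∧ true                  ≡⟨ ∧-identityʳ (f i) ⟩
  f i                         ∎
  where
  open ≡-Reasoning
  off-diagonal : ∀ j → j ≢ i → f j ∧ ⌊ j ≟ i ⌋ ≡ false
  off-diagonal j j≢i =
    trans (cong (f j ∧_) (trans (isYes≗does (j ≟ i)) (dec-false (j ≟ i) j≢i))) (∧-zeroʳ (f j))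

rowSumAt-modelMatrix : ∀ {n} (e₁ e₂ : Fin n → Fin n) (B : Subset n) (i : Fin n) →
  rowSumAt (modelMatrix e₁ e₂) B i ≡ (lookup B i xor lookup B (e₁ i)) xor lookup B (e₂ i)
rowSumAt-modelMatrix {n} e₁ e₂ B i = begin
  rowSumAt (modelMatrix e₁ e₂) B i
    ≡⟨ foldr-xor-tabulate (λ j → b j ∧ modelMatrix e₁ e₂ j i) ⟩
  sum (λ j → b j ∧ ((δ i j xor δ (e₁ i) j) xor δ (e₂ i) j))
    ≡⟨ sum-cong-≗ (λ j → trans (∧-distribˡ-xor (b j) _ _)
                               (cong (_xor (b j ∧ δ (e₂ i) j)) (∧-distribˡ-xor (b j) _ _))) ⟩
  sum (λ j → ((b j ∧ δ i j) xor (b j ∧ δ (e₁ i) j)) xor (b j ∧ δ (e₂ i) j))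
    ≡⟨ trans (∑-distrib-+ (λ j → (b j ∧ δ i j) xor (b j ∧ δ (e₁ i) j)) (λ j → b j ∧ δ (e₂ i) j))
             (cong (_xor sum (λ j → b j ∧ δ (e₂ i) j))
                   (∑-distrib-+ (λ j → b j ∧ δ i j) (λ j → b j ∧ δ (e₁ i) j))) ⟩
  (sum (λ j → b j ∧ δ i j) xor sum (λ j → b j ∧ δ (e₁ i) j)) xor sum (λ j → b j ∧ δ (e₂ i) j)
    ≡⟨ cong₂ _xor_ (cong₂ _xor_ (sum-∧-δ b i) (sum-∧-δ b (e₁ i))) (sum-∧-δ b (e₂ i)) ⟩
  (b i xor b (e₁ i)) xor b (e₂ i)
    ∎
  where
  open ≡-Reasoning
  b : Fin n → Bool
  b = lookup B
  δ : Fin n → Fin n → Bool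
  δ a j = ⌊ j ≟ a ⌋

xor≡false⇔≡ : ∀ a b → a xor b ≡ false ⇔ a ≡ b
xor≡false⇔≡ false false = mk⇔ (λ _ → refl) (λ _ → refl)
xor≡false⇔≡ false true  = mk⇔ (λ ()) (λ ())
xor≡false⇔≡ true  false = mk⇔ (λ ()) (λ ())
xor≡false⇔≡ true  true  = mk⇔ (λ _ → refl) (λ _ → refl)

ColumnRule : ∀ {n} → (Fin n → Fin n) → (Fin n → Fin n) → Subset n → Set
ColumnRule e₁ e₂ B = ∀ i → lookup B i ≡ lookup B (e₁ i) xor lookup B (e₂ i)

isDependency-modelMatrix⇔ : ∀ {n} (e₁ e₂ : Fin n → Fin n) (B : Subset n) →
  IsDependency (modelMatrix e₁ e₂) B ⇔ ColumnRule e₁ e₂ B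
isDependency-modelMatrix⇔ e₁ e₂ B = mk⇔
  (λ dep i → Equivalence.to (column⇔ i) (trans (sym (rowSumAt-modelMatrix e₁ e₂ B i)) (dep i)))
  (λ rule i → trans (rowSumAt-modelMatrix e₁ e₂ B i) (Equivalence.from (column⇔ i) (rule i)))
  where
  column⇔ : ∀ i → ((lookup B i xor lookup B (e₁ i)) xor lookup B (e₂ i) ≡ false)
                ⇔ (lookup B i ≡ lookup B (e₁ i) xor lookup B (e₂ i))
  column⇔ i rewrite xor-assoc (lookup B i) (lookup B (e₁ i)) (lookup B (e₂ i)) =
    xor≡false⇔≡ (lookup B i) (lookup B (e₁ i) xor lookup B (e₂ i))

signature : ∀ {n k} → (Fin k → Subset n) → Fin n → Vec Bool k
signature Bs j = tabulate (λ t → lookup (Bs t) j)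

InI-signature : ∀ {n k} (Bs : Fin k → Subset n) (j : Fin n) → InI Bs (signature Bs j) j
InI-signature Bs j t = sym (lookup∘tabulate (λ s → lookup (Bs s) j) t)

≡-⊕⇔ : ∀ {k} (x u v : Vec Bool k) → x ≡ u ⊕ v ⇔ (∀ t → lookup x t ≡ lookup u t xor lookup v t)
≡-⊕⇔ x u v = mk⇔
  (λ { refl t → lookup-zipWith _xor_ t u v })
  (λ pointwise → Pointwise-≡⇒≡ (ext λ t → trans (pointwise t) (sym (lookup-zipWith _xor_ t u v))))

XorRule : ∀ {n k} → (Fin n → Fin n) → (Fin n → Fin n) → (Fin k → Subset n) → Set
XorRule e₁ e₂ Bs = ∀ i x u v → InI Bs x i → InI Bs u (e₁ i) → InI Bs v (e₂ i) → x ≡ u ⊕ v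

xorRule⇔ : ∀ {n k} (e₁ e₂ : Fin n → Fin n) (Bs : Fin k → Subset n) →
  XorRule e₁ e₂ Bs ⇔ (∀ t → ColumnRule e₁ e₂ (Bs t))
xorRule⇔ {n} {k} e₁ e₂ Bs = mk⇔ rule⇒columns columns⇒rule
  where
  open ≡-Reasoning

  rule⇒columns : XorRule e₁ e₂ Bs → ∀ t → ColumnRule e₁ e₂ (Bs t)
  rule⇒columns rule t i = begin
    lookup (Bs t) i                               ≡⟨ InI-signature Bs i t ⟩
    lookup (σ i) t                                ≡⟨ Equivalence.to (≡-⊕⇔ _ _ _) σi≡σe₁i⊕σe₂i t ⟩
    lookup (σ (e₁ i)) t xor lookup (σ (e₂ i)) t   ≡⟨ cong₂ _xor_ (sym (InI-signature Bs (e₁ i) t))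
                                                                  (sym (InI-signature Bs (e₂ i) t)) ⟩
    lookup (Bs t) (e₁ i) xor lookup (Bs t) (e₂ i) ∎
    where
    σ : Fin n → Vec Bool k
    σ = signature Bs
    σi≡σe₁i⊕σe₂i : σ i ≡ σ (e₁ i) ⊕ σ (e₂ i)
    σi≡σe₁i⊕σe₂i =
      rule i _ _ _ (InI-signature Bs i) (InI-signature Bs (e₁ i)) (InI-signature Bs (e₂ i))

  columns⇒rule : (∀ t → ColumnRule e₁ e₂ (Bs t)) → XorRule e₁ e₂ Bs
  columns⇒rule columns i x u v x∋i u∋e₁i v∋e₂i = Equivalence.from (≡-⊕⇔ x u v) λ t → begin
    lookup x t                                    ≡⟨ sym (x∋i t) ⟩
    lookup (Bs t) i                               ≡⟨ columns t i ⟩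
    lookup (Bs t) (e₁ i) xor lookup (Bs t) (e₂ i) ≡⟨ cong₂ _xor_ (u∋e₁i t) (v∋e₂i t) ⟩
    lookup u t xor lookup v t                     ∎

lemma8 : (n k : ℕ) (e₁ e₂ : Fin n → Fin n) (Bs : Fin k → Subset n) →
    ((∀ t → IsDependency (modelMatrix e₁ e₂) (Bs t)) →
      ∀ (i : Fin n) (x u v : Vec Bool k) →
        InI Bs x i → InI Bs u (e₁ i) → InI Bs v (e₂ i) → x ≡ u ⊕ v)
    ×
    ((∀ (i : Fin n) (x u v : Vec Bool k) →
        InI Bs x i → InI Bs u (e₁ i) → InI Bs v (e₂ i) → x ≡ u ⊕ v) →
      ∀ t → IsDependency (modelMatrix e₁ e₂) (Bs t))
lemma8 n k e₁ e₂ Bs =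
  (λ deps → from (xorRule⇔ e₁ e₂ Bs) (λ t → to (isDependency-modelMatrix⇔ e₁ e₂ (Bs t)) (deps t))) ,
  (λ rule t → from (isDependency-modelMatrix⇔ e₁ e₂ (Bs t)) (to (xorRule⇔ e₁ e₂ Bs) rule t))
  where open Equivalence
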